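{- Let $\Gamma = \mathcal{N}(n;a,b,c;k)$ be an edge-transitive Nest graph of girth $3$, and let $\lambda$ be the number of $3$-cycles containing any given edge of $\Gamma$. Then $\lambda = 4$ if and only if $\Gamma \cong \mathcal{N}(4;1,2,3;1)$ (which is isomorphic to $K_{2,2,2,2}$, the complete graph on $8$ vertices minus a perfect matching), and $\lambda = 3$ if and only if $\Gamma \cong \mathcal{N}(5;1,2,3;2)$ (the complement of the Petersen graph).
   Context: For integers $n \geq 4$ and $1 \leq a,b,c,k \leq n-1$ with $k \neq n/2$ and $a,b,c$ pairwise distinct, the Nest graph $\mathcal{N}(n;a,b,c;k)$ is the graph with vertex set $\{u_i : i \in \mathbb{Z}_n\} \cup \{v_i : i \in \mathbb{Z}_n\}$ and edges $u_iu_{i+1}$, $v_iv_{i+k}$, $u_iv_i$, $u_iv_{i+a}$, $u_iv_{i+b}$, $u_iv_{i+c}$ for $i \in \mathbb{Z}_n$ (indices modulo $n$). Since $\Gamma$ is edge-transitive, every edge lies on the same number $\lambda$ of $3$-cycles. -}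

module Defs where

open import Data.Nat using (ℕ; zero; suc; _+_; _*_; _≤_; _≡ᵇ_)
open import Data.Nat.DivMod using (_%_)
open import Data.Fin using (Fin; toℕ)
open import Data.List using (List; map; _++_; allFin)
open import Data.Nat.ListAction using (sum)
open import Data.Bool using (Bool; true; false; _∨_; _∧_; if_then_else_; T)
open import Data.Sum using (_⊎_; inj₁; inj₂)
open import Data.Product using (Σ; _×_; _,_)
open import Relation.Binary.PropositionalEquality using (_≡_; _≢_)
open import Function.Bundles using (Bijection; _⤖_)

record Graph : Set₁ where
  field
    Vertex   : Set
    vertices : List Vertex
    adj      : Vertex → Vertex → Bool

open Graph public

Adj : (Γ : Graph) → Vertex Γ → Vertex Γ → Set
Adj Γ x y = T (adj Γ x y)

record _≅_ (Γ Δ : Graph) : Set where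
  field
    bij      : Vertex Γ ⤖ Vertex Δ
    preserve : ∀ x y → adj Δ (Bijection.to bij x) (Bijection.to bij y) ≡ adj Γ x y

EdgeTransitive : Graph → Set
EdgeTransitive Γ =
  ∀ x y x' y' → Adj Γ x y → Adj Γ x' y' →
  Σ (Γ ≅ Γ) λ σ →
    let f = Bijection.to (_≅_.bij σ) in
    (f x ≡ x' × f y ≡ y') ⊎ (f x ≡ y' × f y ≡ x')

HasGirth3 : Graph → Set
HasGirth3 Γ = Σ (Vertex Γ) λ x → Σ (Vertex Γ) λ y → Σ (Vertex Γ) λ z →
  Adj Γ x y × Adj Γ y z × Adj Γ z x

-- Number of 3-cycles containing the edge xy = number of common neighbours w of x and y.
trianglesOn : (Γ : Graph) → Vertex Γ → Vertex Γ → ℕ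
trianglesOn Γ x y = sum (map (λ w → if adj Γ x w ∧ adj Γ y w then 1 else 0) (vertices Γ))

-- reduction modulo n (n ≥ 4 in all uses)
_mod_ : ℕ → ℕ → ℕ
m mod zero  = m
m mod suc n = m % suc n

step : (n : ℕ) → Fin n → ℕ → Fin n → Bool
step n i s j = ((toℕ i + s) mod n) ≡ᵇ toℕ j

-- Vertices: inj₁ i = u_i, inj₂ i = v_i.
nestAdj : (n a b c k : ℕ) → Fin n ⊎ Fin n → Fin n ⊎ Fin n → Bool
nestAdj n a b c k (inj₁ i) (inj₁ j) = step n i 1 j ∨ step n j 1 i
nestAdj n a b c k (inj₂ i) (inj₂ j) = step n i k j ∨ step n j k i
nestAdj n a b c k (inj₁ i) (inj₂ j) =
  step n i 0 j ∨ step n i a j ∨ step n i b j ∨ step n i c j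
nestAdj n a b c k (inj₂ j) (inj₁ i) =
  step n i 0 j ∨ step n i a j ∨ step n i b j ∨ step n i c j

Nest : (n a b c k : ℕ) → Graph
Nest n a b c k = record
  { Vertex   = Fin n ⊎ Fin n
  ; vertices = map inj₁ (allFin n) ++ map inj₂ (allFin n)
  ; adj      = nestAdj n a b c k
  }

record ValidNest (n a b c k : ℕ) : Set where
  field
    n≥4 : 4 ≤ n
    a-range : 1 ≤ a × suc a ≤ n
    b-range : 1 ≤ b × suc b ≤ n
    c-range : 1 ≤ c × suc c ≤ n
    k-range : 1 ≤ k × suc k ≤ n
    k≢n/2 : 2 * k ≢ n
    a≢b : a ≢ b
    a≢c : a ≢ c
    b≢c : b ≢ c

-- Sort the offsets so that 0 < a < b < c < n and put S = {0, a, b, c}.  The common neighbours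
-- of u₀ and u₁ are the v_j with j and j − 1 both in S, so λ counts the cyclically consecutive
-- pairs in S:  λ = [a = 1] + [b = a + 1] + [c = b + 1] + [c = n − 1].  Hence λ = 4 forces S = ℤ₄,
-- i.e. n = 4 and k ∈ {1, 3}.  If λ = 3, S is an interval {x, …, x + 3} of ℤ_n with n ≥ 5.  For an
-- endpoint v_e of it, exactly one of u₁, u₋₁ is a common neighbour of u₀ and v_e, so both
-- v-neighbours v_{e ± k} of v_e lie in S; their distances to e are then both ±k modulo n, which
-- only happens for n = 5 and k ∈ {2, 3}.  The finitely many graphs that remain are matched with
-- N(4;1,2,3;1) and N(5;1,2,3;2) by isomorphisms checked by evaluation, and the converse
-- directions are the computed triangle counts of these two graphs.

module Submission where

open import Defs
open import Algebra.Bundles using (CommutativeMonoid)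
open import Data.Bool using (Bool; true; false; T; _∧_; _∨_; if_then_else_)
open import Data.Bool.Properties
  using (T?; T-∨; ∨-comm; ∨-commutativeMonoid) renaming (_≟_ to _≟ᵇ_)
open import Data.Empty using (⊥; ⊥-elim)
open import Data.Fin using (Fin; toℕ; zero; suc; fromℕ; fromℕ<)
open import Data.Fin.Properties using (toℕ<n; toℕ-fromℕ; toℕ-fromℕ<; toℕ-injective)
import Data.Fin.Properties as Fin
open import Data.List using (List; []; _∷_; map; filter; allFin)
open import Data.List.Properties using (map-∘; map-cong)
open import Data.List.Membership.Propositional using (_∈_)
open import Data.List.Membership.Propositional.Properties
  using (∈-filter⁺; ∈-filter⁻; ∈-map⁺; ∈-map⁻; ∈-++⁺ˡ; ∈-++⁺ʳ; ∈-allFin)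
open import Data.List.Membership.Propositional.Properties.WithK using (unique∧set⇒bag)
open import Data.List.Relation.Binary.BagAndSetEquality using (∼bag⇒↭)
open import Data.List.Relation.Binary.Permutation.Propositional
  using (_↭_; ↭-refl; ↭-sym; ↭-trans; ↭-prep; ↭-swap)
import Data.List.Relation.Binary.Permutation.Propositional.Properties as ↭
open import Data.List.Relation.Unary.All as All using (All; all?; []; _∷_)
open import Data.List.Relation.Unary.Any using (here; there)
open import Data.List.Relation.Unary.Unique.Propositional using (Unique; []; _∷_)
import Data.List.Relation.Unary.Unique.Propositional.Properties as Unique
open import Data.Nat using (ℕ; zero; suc; _+_; _*_; _∸_; _≤_; _<_; _<?_; z≤n; s≤s; NonZero)
import Data.Nat as ℕ
open import Data.Nat.DivMod using (_%_; m<n⇒m%n≡m; [m+n]%n≡m%n) renaming (_mod_ to _modFin_)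
open import Data.Nat.ListAction using (sum)
open import Data.Nat.ListAction.Properties using (sum-↭)
open import Data.Nat.Properties
open import Data.Product using (_×_; _,_; ∃; ∃₂; proj₁; proj₂)
open import Data.Sum using (_⊎_; inj₁; inj₂; [_,_])
open import Data.Sum.Function.Propositional using (_⊎-cong_)
import Data.Sum.Properties as Sum
open import Function using (_∘_; _⇔_; mk⇔; Equivalence; Inverse)
open import Function.Bundles using (Bijection; mk↔ₛ′)
import Function.Properties.Bijection as ⤖
open import Function.Properties.Bijection using (⤖⇒↔)
import Function.Properties.Equivalence as ⇔
open import Function.Properties.Inverse using (↔⇒⤖; ↔-sym)
open import Relation.Binary.Definitions using (DecidableEquality; Tri; tri<; tri≈; tri>)
open import Relation.Binary.PropositionalEquality
  using (_≡_; _≢_; refl; sym; trans; cong; cong₂; subst; module ≡-Reasoning)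
open import Relation.Nullary using (¬_; yes; no)
open import Relation.Nullary.Decidable using (Dec; True; toWitness; _×-dec_; _→-dec_)
open import Algebra.Properties.CommutativeSemigroup
  (CommutativeMonoid.commutativeSemigroup ∨-commutativeMonoid) using (x∙yz≈y∙xz)
open import Algebra.Properties.CommutativeSemigroup +-commutativeSemigroup using (interchange)

Enumerated : Graph → Set
Enumerated Γ = Unique (vertices Γ) × (∀ x → x ∈ vertices Γ)

indicator : Bool → ℕ
indicator b = if b then 1 else 0

¬T⇒≡false : ∀ {b} → ¬ T b → b ≡ false
¬T⇒≡false {true}  ¬t = ⊥-elim (¬t _)
¬T⇒≡false {false} _  = refl

countTrue : {V : Set} → (V → Bool) → List V → ℕ
countTrue p xs = sum (map (λ x → indicator (p x)) xs)

countTrue-↭ : {V : Set} (p : V → Bool) {xs ys : List V} → xs ↭ ys →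
  countTrue p xs ≡ countTrue p ys
countTrue-↭ p xs↭ys = sum-↭ (↭.map⁺ _ xs↭ys)

countTrue-map : {V W : Set} (p : W → Bool) (f : V → W) (xs : List V) →
  countTrue p (map f xs) ≡ countTrue (p ∘ f) xs
countTrue-map p f xs = cong sum (sym (map-∘ xs))

countTrue-cong : {V : Set} {p q : V → Bool} → (∀ x → p x ≡ q x) → (xs : List V) →
  countTrue p xs ≡ countTrue q xs
countTrue-cong p≗q xs = cong sum (map-cong (λ x → cong indicator (p≗q x)) xs)

countTrue-∧ : {V : Set} (p q : V → Bool) (xs : List V) →
  countTrue (λ x → p x ∧ q x) xs ≡ countTrue q (filter (T? ∘ p) xs)
countTrue-∧ p q [] = refl
countTrue-∧ p q (x ∷ xs) with p x
... | true  = cong (_ +_) (countTrue-∧ p q xs)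
... | false = countTrue-∧ p q xs

unique∧set⇒↭ : {V : Set} {xs ys : List V} → Unique xs → Unique ys →
  (∀ {x} → x ∈ xs ⇔ x ∈ ys) → xs ↭ ys
unique∧set⇒↭ ux uy same = ∼bag⇒↭ (unique∧set⇒bag ux uy same)

vertexMap : {Γ Δ : Graph} → Γ ≅ Δ → Vertex Γ → Vertex Δ
vertexMap σ = Bijection.to (_≅_.bij σ)

≅-sym : {Γ Δ : Graph} → Γ ≅ Δ → Δ ≅ Γ
≅-sym {Γ} {Δ} σ = record { bij = ↔⇒⤖ (↔-sym inv) ; preserve = preserve⁻¹ }
  where
  inv = ⤖⇒↔ (_≅_.bij σ)
  open Inverse inv using (to; from; strictlyInverseˡ)
  preserve⁻¹ : ∀ x y → adj Γ (from x) (from y) ≡ adj Δ x y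
  preserve⁻¹ x y = begin
    adj Γ (from x) (from y)            ≡⟨ sym (_≅_.preserve σ (from x) (from y)) ⟩
    adj Δ (to (from x)) (to (from y))  ≡⟨ cong₂ (adj Δ) (strictlyInverseˡ x) (strictlyInverseˡ y) ⟩
    adj Δ x y                          ∎
    where open ≡-Reasoning

≅-trans : {Γ Δ Θ : Graph} → Γ ≅ Δ → Δ ≅ Θ → Γ ≅ Θ
≅-trans σ τ = record
  { bij = ⤖.trans (_≅_.bij σ) (_≅_.bij τ)
  ; preserve = λ x y → trans (_≅_.preserve τ _ _) (_≅_.preserve σ x y) }

trianglesOn-neighbourhood : (Γ : Graph) → Enumerated Γ → (x : Vertex Γ) (N : List (Vertex Γ)) →
  Unique N → (∀ {w} → w ∈ N ⇔ Adj Γ x w) → ∀ y → trianglesOn Γ x y ≡ countTrue (adj Γ y) N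
trianglesOn-neighbourhood Γ (unique , complete) x N uniqueN N-nbrs y = begin
  countTrue (λ w → adj Γ x w ∧ adj Γ y w) (vertices Γ)
    ≡⟨ countTrue-∧ (adj Γ x) (adj Γ y) (vertices Γ) ⟩
  countTrue (adj Γ y) neighbours
    ≡⟨ countTrue-↭ (adj Γ y) neighbours↭N ⟩
  countTrue (adj Γ y) N
    ∎
  where
  open ≡-Reasoning
  neighbours = filter (T? ∘ adj Γ x) (vertices Γ)
  neighbours↭N : neighbours ↭ N
  neighbours↭N = unique∧set⇒↭ (Unique.filter⁺ (T? ∘ adj Γ x) unique) uniqueN λ {w} → mk⇔
    (λ w∈ → Equivalence.from N-nbrs (proj₂ (∈-filter⁻ (T? ∘ adj Γ x) {xs = vertices Γ} w∈)))
    (λ w∈N → ∈-filter⁺ (T? ∘ adj Γ x) (complete w) (Equivalence.to N-nbrs w∈N))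

trianglesOn-≅ : (Γ Δ : Graph) → Enumerated Γ → Enumerated Δ → (σ : Γ ≅ Δ) →
  ∀ x y → trianglesOn Δ (vertexMap σ x) (vertexMap σ y) ≡ trianglesOn Γ x y
trianglesOn-≅ Γ Δ (uniqueΓ , completeΓ) (uniqueΔ , completeΔ) σ x y = begin
  countTrue common (vertices Δ)          ≡⟨ countTrue-↭ common (↭-sym image↭) ⟩
  countTrue common (map f (vertices Γ))  ≡⟨ countTrue-map common f (vertices Γ) ⟩
  countTrue (common ∘ f) (vertices Γ)    ≡⟨ countTrue-cong preserved (vertices Γ) ⟩
  trianglesOn Γ x y                      ∎
  where
  open ≡-Reasoning
  f = vertexMap σ
  common = λ w → adj Δ (f x) w ∧ adj Δ (f y) w
  preserved : ∀ w → common (f w) ≡ (adj Γ x w ∧ adj Γ y w)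
  preserved w = cong₂ _∧_ (_≅_.preserve σ x w) (_≅_.preserve σ y w)
  image↭ : map f (vertices Γ) ↭ vertices Δ
  image↭ = unique∧set⇒↭ (Unique.map⁺ (Bijection.injective (_≅_.bij σ)) uniqueΓ) uniqueΔ
    λ {w} → mk⇔
    (λ _ → completeΔ w)
    (λ _ → let (v , fv≡w) = Bijection.surjective (_≅_.bij σ) w in
      subst (_∈ map f (vertices Γ)) (fv≡w refl) (∈-map⁺ f (completeΓ v)))

TriangleConstant : Graph → ℕ → Set
TriangleConstant Γ t = ∀ x y → Adj Γ x y → trianglesOn Γ x y ≡ t

TriangleConstant-≅ : {Γ Δ : Graph} {t : ℕ} → Enumerated Γ → Enumerated Δ → Γ ≅ Δ →
  TriangleConstant Γ t → TriangleConstant Δ t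
TriangleConstant-≅ {Γ} {Δ} enumΓ enumΔ σ constΓ x y x~y = begin
  trianglesOn Δ x y          ≡⟨ trianglesOn-≅ Δ Γ enumΔ enumΓ σ⁻¹ x y ⟨
  trianglesOn Γ (g x) (g y)  ≡⟨ constΓ (g x) (g y) (subst T (sym (_≅_.preserve σ⁻¹ x y)) x~y) ⟩
  _                          ∎
  where
  open ≡-Reasoning
  σ⁻¹ = ≅-sym σ
  g = vertexMap σ⁻¹

module _ (Γ Δ : Graph) where

  IsoCertificate : (Vertex Γ → Vertex Δ) → (Vertex Δ → Vertex Γ) → Set
  IsoCertificate f g =
    All (λ x → g (f x) ≡ x) (vertices Γ) × All (λ y → f (g y) ≡ y) (vertices Δ) ×
    All (λ x → All (λ y → adj Δ (f x) (f y) ≡ adj Γ x y) (vertices Γ)) (vertices Γ)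

  isoCertificate? : DecidableEquality (Vertex Γ) → DecidableEquality (Vertex Δ) →
    ∀ f g → Dec (IsoCertificate f g)
  isoCertificate? _≟Γ_ _≟Δ_ f g =
    all? (λ x → g (f x) ≟Γ x) _ ×-dec all? (λ y → f (g y) ≟Δ y) _ ×-dec
    all? (λ x → all? (λ y → adj Δ (f x) (f y) ≟ᵇ adj Γ x y) _) _

  ≅-fromCertificate : (∀ x → x ∈ vertices Γ) → (∀ y → y ∈ vertices Δ) →
    ∀ f g → IsoCertificate f g → Γ ≅ Δ
  ≅-fromCertificate completeΓ completeΔ f g (gf , fg , pres) = record
    { bij = ↔⇒⤖ (mk↔ₛ′ f g (λ y → All.lookup fg (completeΔ y))
                           (λ x → All.lookup gf (completeΓ x)))
    ; preserve = λ x y → All.lookup (All.lookup pres (completeΓ x)) (completeΓ y) }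

triangleConstant? : (Γ : Graph) (t : ℕ) →
  Dec (All (λ x → All (λ y → Adj Γ x y → trianglesOn Γ x y ≡ t) (vertices Γ)) (vertices Γ))
triangleConstant? Γ t = all? (λ x → all? (λ y → T? (adj Γ x y) →-dec (trianglesOn Γ x y ℕ.≟ t)) _) _

TriangleConstant-byComputation : (Γ : Graph) {t : ℕ} → (∀ x → x ∈ vertices Γ) →
  True (triangleConstant? Γ t) → TriangleConstant Γ t
TriangleConstant-byComputation Γ complete checked x y =
  All.lookup (All.lookup (toWitness checked) (complete x)) (complete y)

TriangleConstant-unique : (Γ : Graph) {x y : Vertex Γ} {t s : ℕ} → Adj Γ x y →
  TriangleConstant Γ t → TriangleConstant Γ s → t ≡ s
TriangleConstant-unique Γ {x} {y} x~y const-t const-s =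
  trans (sym (const-t x y x~y)) (const-s x y x~y)

data OneFails (A B C D : Set) : Set where
  fails₁ : ¬ A → B → C → D → OneFails A B C D
  fails₂ : A → ¬ B → C → D → OneFails A B C D
  fails₃ : A → B → ¬ C → D → OneFails A B C D
  fails₄ : A → B → C → ¬ D → OneFails A B C D

Sum4 : Bool → Bool → Bool → Bool → ℕ
Sum4 p q r s = indicator p + (indicator q + (indicator r + (indicator s + 0)))

all-of-four : ∀ p q r s → Sum4 p q r s ≡ 4 → T p × T q × T r × T s
all-of-four true  true  true  true  _  = _
all-of-four true  true  true  false ()
all-of-four true  true  false true  ()
all-of-four true  true  false false ()
all-of-four true  false true  true  ()
all-of-four true  false true  false ()
all-of-four true  false false true  ()
all-of-four true  false false false ()
all-of-four false true  true  true  ()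
all-of-four false true  true  false ()
all-of-four false true  false true  ()
all-of-four false true  false false ()
all-of-four false false true  true  ()
all-of-four false false true  false ()
all-of-four false false false true  ()
all-of-four false false false false ()

one-of-four-fails : ∀ p q r s → Sum4 p q r s ≡ 3 → OneFails (T p) (T q) (T r) (T s)
one-of-four-fails true  true  true  true  ()
one-of-four-fails true  true  true  false _  = fails₄ _ _ _ (λ ())
one-of-four-fails true  true  false true  _  = fails₃ _ _ (λ ()) _
one-of-four-fails true  true  false false ()
one-of-four-fails true  false true  true  _  = fails₂ _ (λ ()) _ _
one-of-four-fails true  false true  false ()
one-of-four-fails true  false false true  ()
one-of-four-fails true  false false false ()
one-of-four-fails false true  true  true  _  = fails₁ (λ ()) _ _ _
one-of-four-fails false true  true  false ()
one-of-four-fails false true  false true  ()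
one-of-four-fails false true  false false ()
one-of-four-fails false false true  true  ()
one-of-four-fails false false true  false ()
one-of-four-fails false false false true  ()
one-of-four-fails false false false false ()

TwoOf : Set → Set → Set → Set
TwoOf A B C = (A × B) ⊎ (A × C) ⊎ (B × C)

TwoOf-map : {A B C A′ B′ C′ : Set} → (A → A′) → (B → B′) → (C → C′) →
  TwoOf A B C → TwoOf A′ B′ C′
TwoOf-map f g h (inj₁ (x , y))         = inj₁ (f x , g y)
TwoOf-map f g h (inj₂ (inj₁ (x , z)))  = inj₂ (inj₁ (f x , h z))
TwoOf-map f g h (inj₂ (inj₂ (y , z)))  = inj₂ (inj₂ (g y , h z))

at-least-two : ∀ p q r → 2 ≤ indicator p + (indicator q + (indicator r + 0)) → TwoOf (T p) (T q) (T r)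
at-least-two true  true  _     _ = inj₁ (_ , _)
at-least-two true  false true  _ = inj₂ (inj₁ (_ , _))
at-least-two false true  true  _ = inj₂ (inj₂ (_ , _))
at-least-two true  false false (s≤s ())
at-least-two false true  false (s≤s ())
at-least-two false false true  (s≤s ())
at-least-two false false false ()

two-of-last-three : ∀ x y p q r → ¬ (T x × T y) →
  indicator x + (indicator y + (indicator false + (indicator p + (indicator q + (indicator r + 0))))) ≡ 3 →
  TwoOf (T p) (T q) (T r)
two-of-last-three true  true  _ _ _ not-both _  = ⊥-elim (not-both (_ , _))
two-of-last-three true  false p q r _        eq = at-least-two p q r (≤-reflexive (sym (suc-injective eq)))
two-of-last-three false true  p q r _        eq = at-least-two p q r (≤-reflexive (sym (suc-injective eq)))
two-of-last-three false false p q r _        eq = at-least-two p q r (≤-trans (n≤1+n 2) (≤-reflexive (sym eq)))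

_≡±_[mod_] : ℕ → ℕ → ℕ → Set
d ≡± k [mod n ] = k ≡ d ⊎ d + k ≡ n

≡±-pair : ∀ {n k d₁ d₂} → d₁ ≡± k [mod n ] → d₂ ≡± k [mod n ] → d₁ ≡ d₂ ⊎ d₁ + d₂ ≡ n
≡±-pair (inj₁ refl) (inj₁ refl) = inj₁ refl
≡±-pair {d₁ = d₁} (inj₁ refl) (inj₂ d₂+k≡n) = inj₂ (trans (+-comm d₁ _) d₂+k≡n)
≡±-pair (inj₂ d₁+k≡n) (inj₁ refl) = inj₂ d₁+k≡n
≡±-pair {k = k} (inj₂ d₁+k≡n) (inj₂ d₂+k≡n) =
  inj₁ (+-cancelʳ-≡ k _ _ (trans d₁+k≡n (sym d₂+k≡n)))

%≡⇔ : ∀ {m n y} .{{_ : NonZero n}} → m < n + n → y < n → m % n ≡ y ⇔ (m ≡ y ⊎ m ≡ y + n)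
%≡⇔ {m} {n} {y} m<2n y<n = mk⇔ to from
  where
  to : m % n ≡ y → m ≡ y ⊎ m ≡ y + n
  to m%n≡y with m <? n
  ... | yes m<n = inj₁ (trans (sym (m<n⇒m%n≡m m<n)) m%n≡y)
  ... | no m≮n = inj₂ (begin
    m             ≡⟨ m∸n+n≡m n≤m ⟨
    (m ∸ n) + n   ≡⟨ cong (_+ n) m∸n≡y ⟩
    y + n         ∎)
    where
    open ≡-Reasoning
    n≤m = ≮⇒≥ m≮n
    m∸n<n : m ∸ n < n
    m∸n<n = +-cancelʳ-< n (m ∸ n) n (subst (_< n + n) (sym (m∸n+n≡m n≤m)) m<2n)
    m∸n≡y : m ∸ n ≡ y
    m∸n≡y = begin
      m ∸ n              ≡⟨ m<n⇒m%n≡m m∸n<n ⟨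
      (m ∸ n) % n        ≡⟨ [m+n]%n≡m%n (m ∸ n) n ⟨
      ((m ∸ n) + n) % n  ≡⟨ cong (_% n) (m∸n+n≡m n≤m) ⟩
      m % n              ≡⟨ m%n≡y ⟩
      y                  ∎
  from : m ≡ y ⊎ m ≡ y + n → m % n ≡ y
  from (inj₁ refl) = m<n⇒m%n≡m y<n
  from (inj₂ refl) = trans ([m+n]%n≡m%n y n) (m<n⇒m%n≡m y<n)

-- For x, s, y < n this says y ≡ x + s (mod n).
Shift : ℕ → ℕ → ℕ → ℕ → Set
Shift n x s y = x + s ≡ y ⊎ x + s ≡ y + n

T-step⇔ : ∀ {n} (i j : Fin n) {s} → s < n → T (step n i s j) ⇔ Shift n (toℕ i) s (toℕ j)
T-step⇔ {suc m} i j {s} s<n = mk⇔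
  (λ t → Equivalence.to (%≡⇔ i+s<2n (toℕ<n j)) (≡ᵇ⇒≡ _ _ t))
  (λ sh → ≡⇒≡ᵇ _ _ (Equivalence.from (%≡⇔ i+s<2n (toℕ<n j)) sh))
  where
  i+s<2n : toℕ i + s < suc m + suc m
  i+s<2n = +-mono-< (toℕ<n i) s<n

Shift-unique : ∀ {n x y s d} → s < n → d < n → Shift n x s y → Shift n x d y → s ≡ d
Shift-unique {x = x} s<n d<n (inj₁ p) (inj₁ q) = +-cancelˡ-≡ x _ _ (trans p (sym q))
Shift-unique {x = x} s<n d<n (inj₂ p) (inj₂ q) = +-cancelˡ-≡ x _ _ (trans p (sym q))
Shift-unique {n} {x} {y} {s} {d} s<n d<n (inj₁ p) (inj₂ q) =
  ⊥-elim (<⇒≱ d<n (subst (n ≤_) (sym d≡s+n) (m≤n+m n s)))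
  where
  d≡s+n : d ≡ s + n
  d≡s+n = +-cancelˡ-≡ x d (s + n) (begin
    x + d        ≡⟨ q ⟩
    y + n        ≡⟨ cong (_+ n) p ⟨
    x + s + n    ≡⟨ +-assoc x s n ⟩
    x + (s + n)  ∎)
    where open ≡-Reasoning
Shift-unique s<n d<n (inj₂ p) (inj₁ q) = sym (Shift-unique d<n s<n (inj₁ q) (inj₂ p))

wrap-around : ∀ q y → q + suc y ≡ y + suc q
wrap-around q y = trans (+-suc q y) (trans (cong suc (+-comm q y)) (sym (+-suc y q)))

NestVertex : ℕ → Set
NestVertex n = Fin n ⊎ Fin n

pattern u i = inj₁ i
pattern v i = inj₂ i

_≟ᵛ_ : ∀ {n} → DecidableEquality (NestVertex n)
_≟ᵛ_ = Sum.≡-dec Fin._≟_ Fin._≟_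

nest-enumerated : ∀ n a b c k → Enumerated (Nest n a b c k)
nest-enumerated n a b c k = unique , complete
  where
  unique = Unique.++⁺ (Unique.map⁺ Sum.inj₁-injective (Unique.allFin⁺ n))
                      (Unique.map⁺ Sum.inj₂-injective (Unique.allFin⁺ n)) disjoint
    where
    disjoint : ∀ {w} → w ∈ map inj₁ (allFin n) × w ∈ map inj₂ (allFin n) → ⊥
    disjoint (p , q) with ∈-map⁻ inj₁ p | ∈-map⁻ inj₂ q
    ... | _ , _ , refl | _ , _ , ()
  complete : ∀ x → x ∈ vertices (Nest n a b c k)
  complete (u i) = ∈-++⁺ˡ (∈-map⁺ inj₁ (∈-allFin i))
  complete (v i) = ∈-++⁺ʳ (map inj₁ (allFin n)) (∈-map⁺ inj₂ (∈-allFin i))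

nestAdj-sym : ∀ {n a b c k} x y → nestAdj n a b c k x y ≡ nestAdj n a b c k y x
nestAdj-sym {n} (u i) (u j) = ∨-comm (step n i 1 j) (step n j 1 i)
nestAdj-sym {n} {k = k} (v i) (v j) = ∨-comm (step n i k j) (step n j k i)
nestAdj-sym (u i) (v j) = refl
nestAdj-sym (v i) (u j) = refl

Nest-≅-sameAdj : ∀ {n a b c k a′ b′ c′ k′} →
  (∀ x y → nestAdj n a b c k x y ≡ nestAdj n a′ b′ c′ k′ x y) → Nest n a b c k ≅ Nest n a′ b′ c′ k′
Nest-≅-sameAdj same = record { bij = ⤖.refl ; preserve = λ x y → sym (same x y) }

Nest-≅-swap₁₂ : ∀ {n a b c k} → Nest n a b c k ≅ Nest n b a c k
Nest-≅-swap₁₂ {n} {a} {b} {c} {k} = Nest-≅-sameAdj same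
  where
  same : ∀ x y → nestAdj n a b c k x y ≡ nestAdj n b a c k x y
  same (u i) (u j) = refl
  same (v i) (v j) = refl
  same (u i) (v j) = cong (step n i 0 j ∨_) (x∙yz≈y∙xz (step n i a j) (step n i b j) (step n i c j))
  same (v j) (u i) = cong (step n i 0 j ∨_) (x∙yz≈y∙xz (step n i a j) (step n i b j) (step n i c j))

Nest-≅-swap₂₃ : ∀ {n a b c k} → Nest n a b c k ≅ Nest n a c b k
Nest-≅-swap₂₃ {n} {a} {b} {c} {k} = Nest-≅-sameAdj same
  where
  same : ∀ x y → nestAdj n a b c k x y ≡ nestAdj n a c b k x y
  same (u i) (u j) = refl
  same (v i) (v j) = refl
  same (u i) (v j) = cong (λ z → step n i 0 j ∨ (step n i a j ∨ z)) (∨-comm (step n i b j) (step n i c j))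
  same (v j) (u i) = cong (λ z → step n i 0 j ∨ (step n i a j ∨ z)) (∨-comm (step n i b j) (step n i c j))

record SortedOffsets (n a b c : ℕ) : Set where
  field
    1≤a : 1 ≤ a
    a<b : a < b
    b<c : b < c
    c<n : c < n

sortOffsets : ∀ {n a b c k} → ValidNest n a b c k →
  ∃ λ a′ → ∃₂ λ b′ c′ → SortedOffsets n a′ b′ c′ × Nest n a b c k ≅ Nest n a′ b′ c′ k
sortOffsets {n} {a} {b} {c} {k} valid = sort (<-cmp a b) (<-cmp b c) (<-cmp a c)
  where
  open ValidNest valid
  sort : Tri (a < b) (a ≡ b) (b < a) → Tri (b < c) (b ≡ c) (c < b) → Tri (a < c) (a ≡ c) (c < a) →
    ∃ λ a′ → ∃₂ λ b′ c′ → SortedOffsets n a′ b′ c′ × Nest n a b c k ≅ Nest n a′ b′ c′ k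
  sort (tri≈ _ a≡b _) _ _ = ⊥-elim (a≢b a≡b)
  sort _ (tri≈ _ b≡c _) _ = ⊥-elim (b≢c b≡c)
  sort _ _ (tri≈ _ a≡c _) = ⊥-elim (a≢c a≡c)
  sort (tri< a<b _ _) (tri< b<c _ _) _ =
    _ , _ , _ , record { 1≤a = proj₁ a-range ; a<b = a<b ; b<c = b<c ; c<n = proj₂ c-range } ,
    Nest-≅-sameAdj (λ _ _ → refl)
  sort (tri< a<b _ _) (tri> _ _ c<b) (tri< a<c _ _) =
    _ , _ , _ , record { 1≤a = proj₁ a-range ; a<b = a<c ; b<c = c<b ; c<n = proj₂ b-range } ,
    Nest-≅-swap₂₃
  sort (tri< a<b _ _) (tri> _ _ c<b) (tri> _ _ c<a) =
    _ , _ , _ , record { 1≤a = proj₁ c-range ; a<b = c<a ; b<c = a<b ; c<n = proj₂ b-range } ,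
    ≅-trans Nest-≅-swap₂₃ Nest-≅-swap₁₂
  sort (tri> _ _ b<a) (tri< b<c _ _) (tri< a<c _ _) =
    _ , _ , _ , record { 1≤a = proj₁ b-range ; a<b = b<a ; b<c = a<c ; c<n = proj₂ c-range } ,
    Nest-≅-swap₁₂
  sort (tri> _ _ b<a) (tri< b<c _ _) (tri> _ _ c<a) =
    _ , _ , _ , record { 1≤a = proj₁ b-range ; a<b = b<c ; b<c = c<a ; c<n = proj₂ a-range } ,
    ≅-trans Nest-≅-swap₁₂ Nest-≅-swap₂₃
  sort (tri> _ _ b<a) (tri> _ _ c<b) _ =
    _ , _ , _ , record { 1≤a = proj₁ c-range ; a<b = c<b ; b<c = b<a ; c<n = proj₂ a-range } ,
    ≅-trans Nest-≅-swap₁₂ (≅-trans Nest-≅-swap₂₃ Nest-≅-swap₁₂)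

Shift⇔≡ : ∀ {n x y s d} → s < n → d < n → Shift n x d y → Shift n x s y ⇔ s ≡ d
Shift⇔≡ s<n d<n shift = mk⇔ (λ shift′ → Shift-unique s<n d<n shift′ shift) λ { refl → shift }

¬Shift-to-self : ∀ {n x s} → s < n → 1 ≤ s → ¬ Shift n x s x
¬Shift-to-self {x = x} s<n 1≤s shift =
  <⇒≢ 1≤s (sym (Shift-unique s<n (<-≤-trans 1≤s (<⇒≤ s<n)) shift (inj₁ (+-identityʳ x))))

Joined : ℕ → ℕ → ℕ → ℕ → Set
Joined n s x y = Shift n x s y ⊎ Shift n y s x

Offset : ℕ → ℕ → ℕ → ℕ → Set
Offset a b c d = 0 ≡ d ⊎ a ≡ d ⊎ b ≡ d ⊎ c ≡ d

module _ {n a b c k : ℕ} where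

  u~v⇔Offset : a < n → b < n → c < n → (i j : Fin n) {d : ℕ} → d < n →
    Shift n (toℕ i) d (toℕ j) → Adj (Nest n a b c k) (u i) (v j) ⇔ Offset a b c d
  u~v⇔Offset a<n b<n c<n i j d<n shift =
    ⇔.trans T-∨ (by (≤-<-trans z≤n d<n) ⊎-cong
    ⇔.trans T-∨ (by a<n ⊎-cong ⇔.trans T-∨ (by b<n ⊎-cong by c<n)))
    where
    by : ∀ {s} → s < n → T (step n i s j) ⇔ s ≡ _
    by s<n = ⇔.trans (T-step⇔ i j s<n) (Shift⇔≡ s<n d<n shift)

  u~u⇔ : 1 < n → (i j : Fin n) → Adj (Nest n a b c k) (u i) (u j) ⇔ Joined n 1 (toℕ i) (toℕ j)
  u~u⇔ 1<n i j = ⇔.trans T-∨ (T-step⇔ i j 1<n ⊎-cong T-step⇔ j i 1<n)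

  v~v⇔ : k < n → (i j : Fin n) → Adj (Nest n a b c k) (v i) (v j) ⇔ Joined n k (toℕ i) (toℕ j)
  v~v⇔ k<n i j = ⇔.trans T-∨ (T-step⇔ i j k<n ⊎-cong T-step⇔ j i k<n)

  Nest-loopless : 1 < n → 1 ≤ k → k < n → ∀ x → ¬ Adj (Nest n a b c k) x x
  Nest-loopless 1<n 1≤k k<n (u i) loop =
    [ ¬Shift-to-self 1<n ≤-refl , ¬Shift-to-self 1<n ≤-refl ] (Equivalence.to (u~u⇔ 1<n i i) loop)
  Nest-loopless 1<n 1≤k k<n (v i) loop =
    [ ¬Shift-to-self k<n 1≤k , ¬Shift-to-self k<n 1≤k ] (Equivalence.to (v~v⇔ k<n i i) loop)

K₂₂₂₂ : Graph
K₂₂₂₂ = Nest 4 1 2 3 1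

Petersenᶜ : Graph
Petersenᶜ = Nest 5 1 2 3 2

K₂₂₂₂-triangles : TriangleConstant K₂₂₂₂ 4
K₂₂₂₂-triangles = TriangleConstant-byComputation K₂₂₂₂ (proj₂ (nest-enumerated 4 1 2 3 1)) _

Petersenᶜ-triangles : TriangleConstant Petersenᶜ 3
Petersenᶜ-triangles = TriangleConstant-byComputation Petersenᶜ (proj₂ (nest-enumerated 5 1 2 3 2)) _

-- Translating the v's by d turns the offset set {0, a, b, c} into {d, a + d, b + d, c + d}.
shiftᵛ : ∀ {m} → ℕ → NestVertex (suc m) → NestVertex (suc m)
shiftᵛ d (u i) = u i
shiftᵛ {m} d (v j) = v ((toℕ j + d) modFin suc m)

Nest-≅-byShift : ∀ {m a b c k a′ b′ c′ k′} (d : ℕ) →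
  True (isoCertificate? (Nest (suc m) a b c k) (Nest (suc m) a′ b′ c′ k′) _≟ᵛ_ _≟ᵛ_
                        (shiftᵛ d) (shiftᵛ (suc m ∸ d))) →
  Nest (suc m) a b c k ≅ Nest (suc m) a′ b′ c′ k′
Nest-≅-byShift {m} {a} {b} {c} {k} {a′} {b′} {c′} {k′} d certified =
  ≅-fromCertificate _ _ (proj₂ (nest-enumerated _ a b c k)) (proj₂ (nest-enumerated _ a′ b′ c′ k′))
    (shiftᵛ d) (shiftᵛ (suc m ∸ d)) (toWitness certified)

Petersenᶜ-byShift : ∀ {a b c k} (d : ℕ) → 2 ≡± k [mod 5 ] →
  True (isoCertificate? (Nest 5 a b c 2) Petersenᶜ _≟ᵛ_ _≟ᵛ_ (shiftᵛ d) (shiftᵛ (5 ∸ d))) →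
  True (isoCertificate? (Nest 5 a b c 3) Petersenᶜ _≟ᵛ_ _≟ᵛ_ (shiftᵛ d) (shiftᵛ (5 ∸ d))) →
  Nest 5 a b c k ≅ Petersenᶜ
Petersenᶜ-byShift d (inj₁ refl) certified₂ _ = Nest-≅-byShift d certified₂
Petersenᶜ-byShift d (inj₂ refl) _ certified₃ = Nest-≅-byShift d certified₃

sum-of-shifted : ∀ i j m p → (i + p) + (j + p) ≡ m + p → (i + j) + p ≡ m
sum-of-shifted i j m p eq = +-cancelʳ-≡ p _ _ (begin
  (i + j) + p + p     ≡⟨ +-assoc (i + j) p p ⟩
  (i + j) + (p + p)   ≡⟨ interchange i p j p ⟨
  (i + p) + (j + p)   ≡⟨ eq ⟩
  m + p               ∎)
  where open ≡-Reasoning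

-- In intervalₓ, S = {0, a, b, c} is the interval {x, …, x + 3} of ℤ_n, n = 4 + p; the equations
-- are those read off the triangles on u₀u₁, the distances those from an endpoint of S to the rest.
interval₀≅K₂₂₂₂ : ∀ {p a b c k} → a ≡ 1 → b ≡ suc a → c ≡ suc b → c ≡ 3 + p →
  1 ≤ k → k < 4 + p → 2 * k ≢ 4 + p → Nest (4 + p) a b c k ≅ K₂₂₂₂
interval₀≅K₂₂₂₂ {k = 1} refl refl refl refl _ _ _ = Nest-≅-byShift 0 _
interval₀≅K₂₂₂₂ {k = 2} refl refl refl refl _ _ 2k≢n = ⊥-elim (2k≢n refl)
interval₀≅K₂₂₂₂ {k = 3} refl refl refl refl _ _ _ = Nest-≅-byShift 0 _
interval₀≅K₂₂₂₂ {k = suc (suc (suc (suc _)))} refl refl refl refl _ (s≤s (s≤s (s≤s (s≤s ())))) _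

interval₀≅Petersenᶜ : ∀ {p a b c k} → a ≡ 1 → b ≡ suc a → c ≡ suc b → c ≢ 3 + p →
  TwoOf (a ≡± k [mod 4 + p ]) (b ≡± k [mod 4 + p ]) (c ≡± k [mod 4 + p ]) →
  Nest (4 + p) a b c k ≅ Petersenᶜ
interval₀≅Petersenᶜ {zero} refl refl refl c≢3 _ = ⊥-elim (c≢3 refl)
interval₀≅Petersenᶜ {suc p} refl refl refl _ (inj₁ (d₁ , d₂)) with ≡±-pair d₁ d₂
... | inj₁ ()
... | inj₂ ()
interval₀≅Petersenᶜ {suc p} refl refl refl _ (inj₂ (inj₁ (d₁ , d₃))) with ≡±-pair d₁ d₃
... | inj₁ ()
... | inj₂ ()
interval₀≅Petersenᶜ {suc p} refl refl refl _ (inj₂ (inj₂ (d₂ , d₃))) with ≡±-pair d₂ d₃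
... | inj₁ ()
... | inj₂ refl = Petersenᶜ-byShift 0 d₂ _ _

interval₋₁≅Petersenᶜ : ∀ {p a b c k} → a ≡ 1 → b ≡ suc a → c ≢ suc b → c ≡ 3 + p →
  TwoOf (b ≡± k [mod 4 + p ]) ((b ∸ a) ≡± k [mod 4 + p ]) ((c ∸ b) ≡± k [mod 4 + p ]) →
  Nest (4 + p) a b c k ≅ Petersenᶜ
interval₋₁≅Petersenᶜ {zero} refl refl c≢3 refl _ = ⊥-elim (c≢3 refl)
interval₋₁≅Petersenᶜ {suc p} refl refl _ refl (inj₁ (d₁ , d₂)) with ≡±-pair d₁ d₂
... | inj₁ ()
... | inj₂ ()
interval₋₁≅Petersenᶜ {suc p} refl refl _ refl (inj₂ (inj₁ (d₁ , d₃))) with ≡±-pair d₁ d₃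
... | inj₁ refl = Petersenᶜ-byShift 1 d₁ _ _
... | inj₂ ()
interval₋₁≅Petersenᶜ {suc p} refl refl _ refl (inj₂ (inj₂ (d₂ , d₃))) with ≡±-pair d₂ d₃
... | inj₁ ()
... | inj₂ ()

interval₋₂≅Petersenᶜ : ∀ {p a b c k} → a ≡ 1 → b ≢ suc a → c ≡ suc b → c ≡ 3 + p →
  TwoOf (a ≡± k [mod 4 + p ]) ((b ∸ a) ≡± k [mod 4 + p ]) ((c ∸ a) ≡± k [mod 4 + p ]) →
  Nest (4 + p) a b c k ≅ Petersenᶜ
interval₋₂≅Petersenᶜ {zero} refl b≢2 refl refl _ = ⊥-elim (b≢2 refl)
interval₋₂≅Petersenᶜ {suc p} refl _ refl refl (inj₁ (d₁ , d₂)) with ≡±-pair d₁ d₂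
... | inj₁ ()
... | inj₂ ()
interval₋₂≅Petersenᶜ {suc p} refl _ refl refl (inj₂ (inj₁ (d₁ , d₃))) with ≡±-pair d₁ d₃
... | inj₁ ()
... | inj₂ ()
interval₋₂≅Petersenᶜ {suc p} refl _ refl refl (inj₂ (inj₂ (d₂ , d₃))) with ≡±-pair d₂ d₃
... | inj₁ ()
... | inj₂ sum with sum-of-shifted 2 3 5 p sum
...   | refl = Petersenᶜ-byShift 2 d₂ _ _

interval₋₃≅Petersenᶜ : ∀ {p a b c k} → a ≢ 1 → b ≡ suc a → c ≡ suc b → c ≡ 3 + p →
  TwoOf (a ≡± k [mod 4 + p ]) (b ≡± k [mod 4 + p ]) (c ≡± k [mod 4 + p ]) →
  Nest (4 + p) a b c k ≅ Petersenᶜ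
interval₋₃≅Petersenᶜ {zero} a≢1 refl refl refl _ = ⊥-elim (a≢1 refl)
interval₋₃≅Petersenᶜ {suc p} _ refl refl refl (inj₁ (d₁ , d₂)) with ≡±-pair d₁ d₂
... | inj₁ ()
... | inj₂ sum with sum-of-shifted 2 3 5 p sum
...   | refl = Petersenᶜ-byShift 3 d₁ _ _
interval₋₃≅Petersenᶜ {suc p} _ refl refl refl (inj₂ (inj₁ (d₁ , d₃))) with ≡±-pair d₁ d₃
... | inj₁ ()
... | inj₂ sum with sum-of-shifted 2 4 5 p sum
...   | ()
interval₋₃≅Petersenᶜ {suc p} _ refl refl refl (inj₂ (inj₂ (d₂ , d₃))) with ≡±-pair d₂ d₃
... | inj₁ ()
... | inj₂ sum with sum-of-shifted 3 4 5 p sum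
...   | ()

-- Offsets are given as successors, so that v_a, v_b, v_c are u₁ shifted by a₀, b₀, c₀ on the nose.
module AroundU₀ {p a₀ b₀ c₀ k : ℕ} (sorted : SortedOffsets (4 + p) (suc a₀) (suc b₀) (suc c₀))
                (1≤k : 1 ≤ k) (k<n : k < 4 + p) where

  open SortedOffsets sorted
  open Equivalence using (to; from)

  private
    n a b c : ℕ
    n = 4 + p
    a = suc a₀
    b = suc b₀
    c = suc c₀

    b<n : b < n
    b<n = <-trans b<c c<n
    a<n : a < n
    a<n = <-trans a<b b<n
    a<c : a < c
    a<c = <-trans a<b b<c

    iₙ₋₁ iᵃ iᵇ iᶜ : Fin n
    iₙ₋₁ = fromℕ (3 + p)
    iᵃ = fromℕ< a<n
    iᵇ = fromℕ< b<n
    iᶜ = fromℕ< c<n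

    toℕ-iₙ₋₁ : toℕ iₙ₋₁ ≡ 3 + p
    toℕ-iₙ₋₁ = toℕ-fromℕ (3 + p)
    toℕ-iᵃ : toℕ iᵃ ≡ a
    toℕ-iᵃ = toℕ-fromℕ< a<n
    toℕ-iᵇ : toℕ iᵇ ≡ b
    toℕ-iᵇ = toℕ-fromℕ< b<n
    toℕ-iᶜ : toℕ iᶜ ≡ c
    toℕ-iᶜ = toℕ-fromℕ< c<n

  Γ : Graph
  Γ = Nest n a b c k

  u₀ u₁ u₋₁ v₀ vᵃ vᵇ vᶜ : NestVertex n
  u₀ = u zero
  u₁ = u (suc zero)
  u₋₁ = u iₙ₋₁
  v₀ = v zero
  vᵃ = v iᵃ
  vᵇ = v iᵇ
  vᶜ = v iᶜ

  N : List (NestVertex n)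
  N = u₁ ∷ u₋₁ ∷ v₀ ∷ vᵃ ∷ vᵇ ∷ vᶜ ∷ []

  u₁∈N : u₁ ∈ N
  u₁∈N = here refl
  u₋₁∈N : u₋₁ ∈ N
  u₋₁∈N = there (here refl)
  v₀∈N : v₀ ∈ N
  v₀∈N = there (there (here refl))
  vᵃ∈N : vᵃ ∈ N
  vᵃ∈N = there (there (there (here refl)))
  vᵇ∈N : vᵇ ∈ N
  vᵇ∈N = there (there (there (there (here refl))))
  vᶜ∈N : vᶜ ∈ N
  vᶜ∈N = there (there (there (there (there (here refl)))))

  private
    u~u : ∀ (i j : Fin n) {x y} → toℕ i ≡ x → toℕ j ≡ y → Adj Γ (u i) (u j) ⇔ Joined n 1 x y
    u~u i j refl refl = u~u⇔ {a = a} {b} {c} {k} (s≤s (s≤s z≤n)) i j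

    u~v : ∀ (i j : Fin n) {x y d} → toℕ i ≡ x → toℕ j ≡ y → d < n → Shift n x d y →
      Adj Γ (u i) (v j) ⇔ Offset a b c d
    u~v i j refl refl = u~v⇔Offset {k = k} a<n b<n c<n i j

    loopless : ∀ x → ¬ Adj Γ x x
    loopless = Nest-loopless (s≤s (s≤s z≤n)) 1≤k k<n

    ∈N-byIndex : (side : Fin n → NestVertex n) {i j : Fin n} → toℕ i ≡ toℕ j → side j ∈ N → side i ∈ N
    ∈N-byIndex side i≡j = subst (_∈ N) (cong side (sym (toℕ-injective i≡j)))

  N⊆neighbours : ∀ {w} → w ∈ N → Adj Γ u₀ w
  N⊆neighbours = All.lookup {P = Adj Γ u₀}
    ( from (u~u zero (suc zero) refl refl) (inj₁ (inj₁ refl))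
    ∷ from (u~u zero iₙ₋₁ refl toℕ-iₙ₋₁) (inj₂ (inj₂ (wrap-around (3 + p) 0)))
    ∷ from (u~v zero zero refl refl (s≤s z≤n) (inj₁ refl)) (inj₁ refl)
    ∷ from (u~v zero iᵃ refl toℕ-iᵃ a<n (inj₁ refl)) (inj₂ (inj₁ refl))
    ∷ from (u~v zero iᵇ refl toℕ-iᵇ b<n (inj₁ refl)) (inj₂ (inj₂ (inj₁ refl)))
    ∷ from (u~v zero iᶜ refl toℕ-iᶜ c<n (inj₁ refl)) (inj₂ (inj₂ (inj₂ refl)))
    ∷ [])

  neighbours⊆N : ∀ w → Adj Γ u₀ w → w ∈ N
  neighbours⊆N (u j) u₀~w with to (u~u zero j refl refl) u₀~w
  ... | inj₁ (inj₁ 1≡j) = ∈N-byIndex u (sym 1≡j) u₁∈N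
  ... | inj₁ (inj₂ 1≡j+n) = ⊥-elim (<⇒≢ (≤-trans (s≤s (s≤s z≤n)) (m≤n+m n (toℕ j))) 1≡j+n)
  ... | inj₂ (inj₁ j+1≡0) = ⊥-elim (m+1+n≢0 (toℕ j) j+1≡0)
  ... | inj₂ (inj₂ j+1≡n) = ∈N-byIndex u (trans j≡3+p (sym toℕ-iₙ₋₁)) u₋₁∈N
    where j≡3+p = +-cancelʳ-≡ 1 (toℕ j) (3 + p) (trans j+1≡n (+-comm 1 (3 + p)))
  neighbours⊆N (v j) u₀~w with to (u~v zero j refl refl (toℕ<n j) (inj₁ refl)) u₀~w
  ... | inj₁ 0≡j = ∈N-byIndex v (sym 0≡j) v₀∈N
  ... | inj₂ (inj₁ a≡j) = ∈N-byIndex v (trans (sym a≡j) (sym toℕ-iᵃ)) vᵃ∈N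
  ... | inj₂ (inj₂ (inj₁ b≡j)) = ∈N-byIndex v (trans (sym b≡j) (sym toℕ-iᵇ)) vᵇ∈N
  ... | inj₂ (inj₂ (inj₂ c≡j)) = ∈N-byIndex v (trans (sym c≡j) (sym toℕ-iᶜ)) vᶜ∈N

  N-unique : Unique N
  N-unique = (u₁≢u₋₁ ∷ (λ ()) ∷ (λ ()) ∷ (λ ()) ∷ (λ ()) ∷ [])
           ∷ ((λ ()) ∷ (λ ()) ∷ (λ ()) ∷ (λ ()) ∷ [])
           ∷ (v≢v refl toℕ-iᵃ (s≤s z≤n) ∷ v≢v refl toℕ-iᵇ (s≤s z≤n) ∷ v≢v refl toℕ-iᶜ (s≤s z≤n) ∷ [])
           ∷ (v≢v toℕ-iᵃ toℕ-iᵇ a<b ∷ v≢v toℕ-iᵃ toℕ-iᶜ a<c ∷ [])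
           ∷ (v≢v toℕ-iᵇ toℕ-iᶜ b<c ∷ [])
           ∷ [] ∷ []
    where
    u₁≢u₋₁ : u₁ ≢ u₋₁
    u₁≢u₋₁ u₁≡u₋₁ with trans (cong toℕ (Sum.inj₁-injective u₁≡u₋₁)) toℕ-iₙ₋₁
    ... | ()
    v≢v : ∀ {i j : Fin n} {x y} → toℕ i ≡ x → toℕ j ≡ y → x < y → _≢_ {A = NestVertex n} (v i) (v j)
    v≢v refl refl x<y refl = <-irrefl refl x<y

  triangles-at-u₀ : ∀ y → trianglesOn Γ u₀ y ≡ countTrue (adj Γ y) N
  triangles-at-u₀ = trianglesOn-neighbourhood Γ (nest-enumerated n a b c k) u₀ N N-unique
    (mk⇔ N⊆neighbours (neighbours⊆N _))

  private
    offset-below-a : ∀ {d} → d < a → Offset a b c d → 0 ≡ d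
    offset-below-a d<a (inj₁ 0≡d) = 0≡d
    offset-below-a d<a (inj₂ (inj₁ refl)) = ⊥-elim (<-irrefl refl d<a)
    offset-below-a d<a (inj₂ (inj₂ (inj₁ refl))) = ⊥-elim (<-asym d<a a<b)
    offset-below-a d<a (inj₂ (inj₂ (inj₂ refl))) = ⊥-elim (<-asym d<a a<c)

    offset-between-0-b : ∀ {d} → 0 < d → d < b → Offset a b c d → a ≡ d
    offset-between-0-b 0<d d<b (inj₁ refl) = ⊥-elim (<-irrefl refl 0<d)
    offset-between-0-b 0<d d<b (inj₂ (inj₁ a≡d)) = a≡d
    offset-between-0-b 0<d d<b (inj₂ (inj₂ (inj₁ refl))) = ⊥-elim (<-irrefl refl d<b)
    offset-between-0-b 0<d d<b (inj₂ (inj₂ (inj₂ refl))) = ⊥-elim (<-asym d<b b<c)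

    offset-between-a-c : ∀ {d} → a < d → d < c → Offset a b c d → b ≡ d
    offset-between-a-c a<d d<c (inj₁ refl) = ⊥-elim (<-asym a<d (s≤s z≤n))
    offset-between-a-c a<d d<c (inj₂ (inj₁ refl)) = ⊥-elim (<-irrefl refl a<d)
    offset-between-a-c a<d d<c (inj₂ (inj₂ (inj₁ b≡d))) = b≡d
    offset-between-a-c a<d d<c (inj₂ (inj₂ (inj₂ refl))) = ⊥-elim (<-irrefl refl d<c)

    offset-above-b : ∀ {d} → b < d → Offset a b c d → c ≡ d
    offset-above-b b<d (inj₁ refl) = ⊥-elim (<-asym b<d (s≤s z≤n))
    offset-above-b b<d (inj₂ (inj₁ refl)) = ⊥-elim (<-asym b<d a<b)
    offset-above-b b<d (inj₂ (inj₂ (inj₁ refl))) = ⊥-elim (<-irrefl refl b<d)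
    offset-above-b b<d (inj₂ (inj₂ (inj₂ c≡d))) = c≡d

  u₁~v₀⇔ : Adj Γ u₁ v₀ ⇔ c ≡ 3 + p
  u₁~v₀⇔ = ⇔.trans (u~v (suc zero) zero refl refl (n<1+n _) (inj₂ refl))
    (mk⇔ (offset-above-b (<-≤-trans b<c (≤-pred c<n))) (inj₂ ∘ inj₂ ∘ inj₂))

  u₁~vᵃ⇔ : Adj Γ u₁ vᵃ ⇔ a ≡ 1
  u₁~vᵃ⇔ = ⇔.trans (u~v (suc zero) iᵃ refl toℕ-iᵃ (<-trans (n<1+n a₀) a<n) (inj₁ refl)) (mk⇔
    (λ offset → cong suc (sym (offset-below-a (n<1+n a₀) offset)))
    (λ a≡1 → inj₁ (sym (suc-injective a≡1))))

  u₁~vᵇ⇔ : Adj Γ u₁ vᵇ ⇔ b ≡ suc a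
  u₁~vᵇ⇔ = ⇔.trans (u~v (suc zero) iᵇ refl toℕ-iᵇ (<-trans (n<1+n b₀) b<n) (inj₁ refl)) (mk⇔
    (λ offset → cong suc (sym (offset-between-0-b (≤-trans (s≤s z≤n) (≤-pred a<b)) (n<1+n b₀) offset)))
    (λ b≡1+a → inj₂ (inj₁ (sym (suc-injective b≡1+a)))))

  u₁~vᶜ⇔ : Adj Γ u₁ vᶜ ⇔ c ≡ suc b
  u₁~vᶜ⇔ = ⇔.trans (u~v (suc zero) iᶜ refl toℕ-iᶜ (<-trans (n<1+n c₀) c<n) (inj₁ refl)) (mk⇔
    (λ offset → cong suc (sym (offset-between-a-c (<-≤-trans a<b (≤-pred b<c)) (n<1+n c₀) offset)))
    (λ c≡1+b → inj₂ (inj₂ (inj₁ (sym (suc-injective c≡1+b))))))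

  u₋₁~v₀⇒ : Adj Γ u₋₁ v₀ → a ≡ 1
  u₋₁~v₀⇒ = offset-between-0-b (s≤s z≤n) (<-≤-trans (s≤s 1≤a) a<b)
    ∘ to (u~v iₙ₋₁ zero toℕ-iₙ₋₁ refl (s≤s (s≤s z≤n)) (inj₂ (wrap-around (3 + p) 0)))

  u₋₁~vᵃ⇒ : Adj Γ u₋₁ vᵃ → b ≡ suc a
  u₋₁~vᵃ⇒ = offset-between-a-c (n<1+n a) (≤-<-trans a<b b<c)
    ∘ to (u~v iₙ₋₁ iᵃ toℕ-iₙ₋₁ toℕ-iᵃ (≤-<-trans a<b b<n) (inj₂ (wrap-around (3 + p) a)))

  u₋₁~vᵇ⇒ : Adj Γ u₋₁ vᵇ → c ≡ suc b
  u₋₁~vᵇ⇒ = offset-above-b (n<1+n b)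
    ∘ to (u~v iₙ₋₁ iᵇ toℕ-iₙ₋₁ toℕ-iᵇ (≤-<-trans b<c c<n) (inj₂ (wrap-around (3 + p) b)))

  u₁≁u₋₁ : ¬ Adj Γ u₁ u₋₁
  u₁≁u₋₁ adjacent with to (u~u (suc zero) iₙ₋₁ refl toℕ-iₙ₋₁) adjacent
  ... | inj₁ (inj₁ ())
  ... | inj₁ (inj₂ ())
  ... | inj₂ (inj₁ ())
  ... | inj₂ (inj₂ 3+p+1≡1+n) =
    1+n≢n (sym (+-cancelʳ-≡ 1 (3 + p) (4 + p) (trans 3+p+1≡1+n (+-comm 1 (4 + p)))))

  triangles-u₀u₁ : trianglesOn Γ u₀ u₁ ≡ Sum4 (adj Γ u₁ v₀) (adj Γ u₁ vᵃ) (adj Γ u₁ vᵇ) (adj Γ u₁ vᶜ)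
  triangles-u₀u₁ = trans (triangles-at-u₀ u₁)
    (cong₂ (λ self opposite → indicator self + (indicator opposite + rest))
           (¬T⇒≡false (loopless u₁)) (¬T⇒≡false u₁≁u₋₁))
    where rest = Sum4 (adj Γ u₁ v₀) (adj Γ u₁ vᵃ) (adj Γ u₁ vᵇ) (adj Γ u₁ vᶜ)

  two-v-neighbours : ∀ (j x y z : Fin n) → N ↭ u₁ ∷ u₋₁ ∷ v j ∷ v x ∷ v y ∷ v z ∷ [] →
    ¬ (Adj Γ u₁ (v j) × Adj Γ u₋₁ (v j)) → trianglesOn Γ u₀ (v j) ≡ 3 →
    TwoOf (Adj Γ (v j) (v x)) (Adj Γ (v j) (v y)) (Adj Γ (v j) (v z))
  two-v-neighbours j x y z N↭ not-both three = two-of-last-three _ _ _ _ _ not-both (begin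
    indicator (adj Γ (v j) u₁) + (indicator (adj Γ (v j) u₋₁) + (indicator false + others))
      ≡⟨ cong (λ self → indicator (adj Γ (v j) u₁) + (indicator (adj Γ (v j) u₋₁) + (indicator self + others)))
              (¬T⇒≡false (loopless (v j))) ⟨
    countTrue (adj Γ (v j)) (u₁ ∷ u₋₁ ∷ v j ∷ v x ∷ v y ∷ v z ∷ [])
      ≡⟨ countTrue-↭ (adj Γ (v j)) N↭ ⟨
    countTrue (adj Γ (v j)) N
      ≡⟨ triangles-at-u₀ (v j) ⟨
    trianglesOn Γ u₀ (v j)
      ≡⟨ three ⟩
    3 ∎)
    where
    open ≡-Reasoning
    others = countTrue (adj Γ (v j)) (v x ∷ v y ∷ v z ∷ [])

  v~v⇒≡± : ∀ {i j : Fin n} {x y d} → toℕ i ≡ x → toℕ j ≡ y → x + d ≡ y →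
    Adj Γ (v i) (v j) → d ≡± k [mod n ]
  v~v⇒≡± {i} {j} {x} {y} {d} refl refl x+d≡y adjacent with to (v~v⇔ {a = a} {b} {c} k<n i j) adjacent
  ... | inj₁ shift = inj₁ (Shift-unique k<n d<n shift (inj₁ x+d≡y))
    where d<n = ≤-<-trans (m≤n+m d x) (subst (_< n) (sym x+d≡y) (toℕ<n j))
  ... | inj₂ (inj₁ y+k≡x) =
    ⊥-elim (<⇒≢ (≤-<-trans (subst (x ≤_) x+d≡y (m≤m+n x d)) (m<m+n y 1≤k)) (sym y+k≡x))
  ... | inj₂ (inj₂ y+k≡x+n) = inj₂ (+-cancelˡ-≡ x _ _ (begin
    x + (d + k)  ≡⟨ +-assoc x d k ⟨
    x + d + k    ≡⟨ cong (_+ k) x+d≡y ⟩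
    y + k        ≡⟨ y+k≡x+n ⟩
    x + n        ∎))
    where open ≡-Reasoning

  v~v⇒≡±ʳ : ∀ {i j : Fin n} {x y d} → toℕ i ≡ x → toℕ j ≡ y → x + d ≡ y →
    Adj Γ (v j) (v i) → d ≡± k [mod n ]
  v~v⇒≡±ʳ {i} {j} i≡x j≡y x+d≡y =
    v~v⇒≡± i≡x j≡y x+d≡y ∘ subst T (nestAdj-sym {n} {a} {b} {c} {k} (v j) (v i))

  module _ {t : ℕ} (constant : TriangleConstant Γ t) where

    private
      triangles-u₀ : ∀ {w} → w ∈ N → trianglesOn Γ u₀ w ≡ t
      triangles-u₀ {w} w∈N = constant u₀ w (N⊆neighbours w∈N)

      u₁-count : Sum4 (adj Γ u₁ v₀) (adj Γ u₁ vᵃ) (adj Γ u₁ vᵇ) (adj Γ u₁ vᶜ) ≡ t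
      u₁-count = trans (sym triangles-u₀u₁) (triangles-u₀ u₁∈N)

      v₀-distances : t ≡ 3 → ¬ (Adj Γ u₁ v₀ × Adj Γ u₋₁ v₀) →
        TwoOf (a ≡± k [mod n ]) (b ≡± k [mod n ]) (c ≡± k [mod n ])
      v₀-distances t≡3 not-both =
        TwoOf-map (v~v⇒≡± refl toℕ-iᵃ refl) (v~v⇒≡± refl toℕ-iᵇ refl) (v~v⇒≡± refl toℕ-iᶜ refl)
          (two-v-neighbours zero iᵃ iᵇ iᶜ ↭-refl not-both (trans (triangles-u₀ v₀∈N) t≡3))

      vᵃ-distances : t ≡ 3 → ¬ (Adj Γ u₁ vᵃ × Adj Γ u₋₁ vᵃ) →
        TwoOf (a ≡± k [mod n ]) ((b ∸ a) ≡± k [mod n ]) ((c ∸ a) ≡± k [mod n ])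
      vᵃ-distances t≡3 not-both =
        TwoOf-map (v~v⇒≡±ʳ refl toℕ-iᵃ refl)
                  (v~v⇒≡± toℕ-iᵃ toℕ-iᵇ (m+[n∸m]≡n (<⇒≤ a<b)))
                  (v~v⇒≡± toℕ-iᵃ toℕ-iᶜ (m+[n∸m]≡n (<⇒≤ a<c)))
          (two-v-neighbours iᵃ zero iᵇ iᶜ N↭ not-both (trans (triangles-u₀ vᵃ∈N) t≡3))
        where N↭ = ↭-prep u₁ (↭-prep u₋₁ (↭-swap v₀ vᵃ ↭-refl))

      vᵇ-distances : t ≡ 3 → ¬ (Adj Γ u₁ vᵇ × Adj Γ u₋₁ vᵇ) →
        TwoOf (b ≡± k [mod n ]) ((b ∸ a) ≡± k [mod n ]) ((c ∸ b) ≡± k [mod n ])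
      vᵇ-distances t≡3 not-both =
        TwoOf-map (v~v⇒≡±ʳ refl toℕ-iᵇ refl)
                  (v~v⇒≡±ʳ toℕ-iᵃ toℕ-iᵇ (m+[n∸m]≡n (<⇒≤ a<b)))
                  (v~v⇒≡± toℕ-iᵇ toℕ-iᶜ (m+[n∸m]≡n (<⇒≤ b<c)))
          (two-v-neighbours iᵇ zero iᵃ iᶜ N↭ not-both (trans (triangles-u₀ vᵇ∈N) t≡3))
        where
        N↭ = ↭-prep u₁ (↭-prep u₋₁ (↭-trans (↭-prep v₀ (↭-swap vᵃ vᵇ ↭-refl)) (↭-swap v₀ vᵇ ↭-refl)))

    t≡4⇒≅K₂₂₂₂ : 2 * k ≢ n → t ≡ 4 → Γ ≅ K₂₂₂₂
    t≡4⇒≅K₂₂₂₂ 2k≢n t≡4 with all-of-four _ _ _ _ (trans u₁-count t≡4)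
    ... | u₁~v₀ , u₁~vᵃ , u₁~vᵇ , u₁~vᶜ =
      interval₀≅K₂₂₂₂ (to u₁~vᵃ⇔ u₁~vᵃ) (to u₁~vᵇ⇔ u₁~vᵇ) (to u₁~vᶜ⇔ u₁~vᶜ) (to u₁~v₀⇔ u₁~v₀)
        1≤k k<n 2k≢n

    t≡3⇒≅Petersenᶜ : t ≡ 3 → Γ ≅ Petersenᶜ
    t≡3⇒≅Petersenᶜ t≡3 with one-of-four-fails _ _ _ _ (trans u₁-count t≡3)
    ... | fails₁ u₁≁v₀ u₁~vᵃ u₁~vᵇ u₁~vᶜ =
      interval₀≅Petersenᶜ (to u₁~vᵃ⇔ u₁~vᵃ) (to u₁~vᵇ⇔ u₁~vᵇ) (to u₁~vᶜ⇔ u₁~vᶜ)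
        (u₁≁v₀ ∘ from u₁~v₀⇔)
        (v₀-distances t≡3 (u₁≁v₀ ∘ proj₁))
    ... | fails₂ u₁~v₀ u₁≁vᵃ u₁~vᵇ u₁~vᶜ =
      interval₋₃≅Petersenᶜ (u₁≁vᵃ ∘ from u₁~vᵃ⇔) (to u₁~vᵇ⇔ u₁~vᵇ) (to u₁~vᶜ⇔ u₁~vᶜ)
        (to u₁~v₀⇔ u₁~v₀)
        (v₀-distances t≡3 (u₁≁vᵃ ∘ from u₁~vᵃ⇔ ∘ u₋₁~v₀⇒ ∘ proj₂))
    ... | fails₃ u₁~v₀ u₁~vᵃ u₁≁vᵇ u₁~vᶜ =
      interval₋₂≅Petersenᶜ (to u₁~vᵃ⇔ u₁~vᵃ) (u₁≁vᵇ ∘ from u₁~vᵇ⇔) (to u₁~vᶜ⇔ u₁~vᶜ)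
        (to u₁~v₀⇔ u₁~v₀)
        (vᵃ-distances t≡3 (u₁≁vᵇ ∘ from u₁~vᵇ⇔ ∘ u₋₁~vᵃ⇒ ∘ proj₂))
    ... | fails₄ u₁~v₀ u₁~vᵃ u₁~vᵇ u₁≁vᶜ =
      interval₋₁≅Petersenᶜ (to u₁~vᵃ⇔ u₁~vᵃ) (to u₁~vᵇ⇔ u₁~vᵇ) (u₁≁vᶜ ∘ from u₁~vᶜ⇔)
        (to u₁~v₀⇔ u₁~v₀)
        (vᵇ-distances t≡3 (u₁≁vᶜ ∘ from u₁~vᶜ⇔ ∘ u₋₁~vᵇ⇒ ∘ proj₂))

sorted-characterisation : ∀ {n a b c k t} → 4 ≤ n → SortedOffsets n a b c →
  1 ≤ k → k < n → 2 * k ≢ n → TriangleConstant (Nest n a b c k) t →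
  (t ≡ 4 → Nest n a b c k ≅ K₂₂₂₂) × (t ≡ 3 → Nest n a b c k ≅ Petersenᶜ)
sorted-characterisation (s≤s (s≤s (s≤s (s≤s _))))
  sorted@record { 1≤a = s≤s _ ; a<b = s≤s _ ; b<c = s≤s _ } 1≤k k<n 2k≢n constant =
  t≡4⇒≅K₂₂₂₂ constant 2k≢n , t≡3⇒≅Petersenᶜ constant
  where open AroundU₀ sorted 1≤k k<n

-- Edge-transitivity and girth 3 serve in the paper only to make λ well defined, which is the
-- hypothesis on t here.
lemma4p1 : (n a b c k : ℕ) → ValidNest n a b c k →
    EdgeTransitive (Nest n a b c k) → HasGirth3 (Nest n a b c k) →
    (t : ℕ) → (∀ x y → Adj (Nest n a b c k) x y → trianglesOn (Nest n a b c k) x y ≡ t) →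
    ((t ≡ 4) ⇔ (Nest n a b c k ≅ Nest 4 1 2 3 1)) ×
    ((t ≡ 3) ⇔ (Nest n a b c k ≅ Nest 5 1 2 3 2))
lemma4p1 n a b c k valid _ _ t constant with sortOffsets valid
... | a′ , b′ , c′ , sorted , σ =
  mk⇔ (≅-trans σ ∘ proj₁ sorted-case)
      (λ τ → TriangleConstant-unique K₂₂₂₂ {u zero} {u (suc zero)} _ (transfer τ) K₂₂₂₂-triangles) ,
  mk⇔ (≅-trans σ ∘ proj₂ sorted-case)
      (λ τ → TriangleConstant-unique Petersenᶜ {u zero} {u (suc zero)} _ (transfer τ) Petersenᶜ-triangles)
  where
  open ValidNest valid
  sorted-case : (t ≡ 4 → Nest n a′ b′ c′ k ≅ K₂₂₂₂) × (t ≡ 3 → Nest n a′ b′ c′ k ≅ Petersenᶜ)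
  sorted-case = sorted-characterisation n≥4 sorted (proj₁ k-range) (proj₂ k-range) k≢n/2
    (TriangleConstant-≅ (nest-enumerated n a b c k) (nest-enumerated n a′ b′ c′ k) σ constant)
  transfer : ∀ {m a″ b″ c″ k″} → Nest n a b c k ≅ Nest m a″ b″ c″ k″ → TriangleConstant (Nest m a″ b″ c″ k″) t
  transfer {m} {a″} {b″} {c″} {k″} τ =
    TriangleConstant-≅ (nest-enumerated n a b c k) (nest-enumerated m a″ b″ c″ k″) τ constant
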